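{- In SC2Int: if $(\Gamma, D, D; \Delta) \vdash^{*} C$ is derivable with a height of derivation at most $n$, then $(\Gamma, D; \Delta) \vdash^{*} C$ is derivable with a height of derivation at most $n$; and if $(\Gamma; \Delta, D, D) \vdash^{*} C$ is derivable with a height of derivation at most $n$, then $(\Gamma; \Delta, D) \vdash^{*} C$ is derivable with a height of derivation at most $n$.
   Context: The language of the bi-intuitionistic logic 2Int is $A ::= p \mid \bot \mid \top \mid (A \wedge A) \mid (A \vee A) \mid (A \rightarrow A) \mid (A \mathbin{ -\!\!<} A)$, where $A \mathbin{ -\!\!<} B$ is co-implication (read "$B$ co-implies $A$"). Sequents have the form $(\Gamma; \Delta) \vdash^{*} C$ with $* \in \{+,-\}$, where $\Gamma$ (assumptions) and $\Delta$ (counterassumptions) are finite, possibly empty multisets. The calculus SC2Int has the following rules (for $* \in \{+,-\}$, $p$ atomic). Zero-premise rules: $(\Gamma, p; \Delta) \vdash^{+} p$; $(\Gamma; \Delta, p) \vdash^{ - } p$; $(\Gamma, \bot; \Delta) \vdash^{*} C$; $(\Gamma; \Delta, \top) \vdash^{*} C$; $(\Gamma; \Delta) \vdash^{ - } \bot$; $(\Gamma; \Delta) \vdash^{+} \top$. $\wedge R^{+}$: from $(\Gamma;\Delta)\vdash^{+}A$ and $(\Gamma;\Delta)\vdash^{+}B$ infer $(\Gamma;\Delta)\vdash^{+}A\wedge B$; $\wedge R^{ - }_{1,2}$: from $(\Gamma;\Delta)\vdash^{ - }A$ (resp. $B$) infer $(\Gamma;\Delta)\vdash^{ - }A\wedge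 B$; $\wedge L^{a}$: from $(\Gamma,A,B;\Delta)\vdash^{*}C$ infer $(\Gamma,A\wedge B;\Delta)\vdash^{*}C$; $\wedge L^{c}$: from $(\Gamma;\Delta,A)\vdash^{*}C$ and $(\Gamma;\Delta,B)\vdash^{*}C$ infer $(\Gamma;\Delta,A\wedge B)\vdash^{*}C$. $\vee R^{+}_{1,2}$: from $(\Gamma;\Delta)\vdash^{+}A$ (resp. $B$) infer $(\Gamma;\Delta)\vdash^{+}A\vee B$; $\vee R^{ - }$: from $(\Gamma;\Delta)\vdash^{ - }A$ and $(\Gamma;\Delta)\vdash^{ - }B$ infer $(\Gamma;\Delta)\vdash^{ - }A\vee B$; $\vee L^{a}$: from $(\Gamma,A;\Delta)\vdash^{*}C$ and $(\Gamma,B;\Delta)\vdash^{*}C$ infer $(\Gamma,A\vee B;\Delta)\vdash^{*}C$; $\vee L^{c}$: from $(\Gamma;\Delta,A,B)\vdash^{*}C$ infer $(\Gamma;\Delta,A\vee B)\vdash^{*}C$. $\rightarrow R^{+}$: from $(\Gamma,A;\Delta)\vdash^{+}B$ infer $(\Gamma;\Delta)\vdash^{+}A\rightarrow B$; $\rightarrow R^{ - }$: from $(\Gamma;\Delta)\vdash^{+}A$ and $(\Gamma;\Delta)\vdash^{ - }B$ infer $(\Gamma;\Delta)\vdash^{ - }A\rightarrow B$; $\rightarrow L^{a}$: from $(\Gamma,A\rightarrow B;\Delta)\vdash^{+}A$ and $(\Gamma,B;\Delta)\vdash^{*}C$ infer $(\Gamma,A\rightarrow B;\Delta)\vdash^{*}C$;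 $\rightarrow L^{c}$: from $(\Gamma,A;\Delta,B)\vdash^{*}C$ infer $(\Gamma;\Delta,A\rightarrow B)\vdash^{*}C$. Co-implication right $+$: from $(\Gamma;\Delta)\vdash^{+}A$ and $(\Gamma;\Delta)\vdash^{ - }B$ infer $(\Gamma;\Delta)\vdash^{+}A\mathbin{ -\!\!<}B$; right $-$: from $(\Gamma;\Delta,B)\vdash^{ - }A$ infer $(\Gamma;\Delta)\vdash^{ - }A\mathbin{ -\!\!<}B$; left $a$: from $(\Gamma,A;\Delta,B)\vdash^{*}C$ infer $(\Gamma,A\mathbin{ -\!\!<}B;\Delta)\vdash^{*}C$; left $c$: from $(\Gamma;\Delta,A\mathbin{ -\!\!<}B)\vdash^{ - }B$ and $(\Gamma;\Delta,A)\vdash^{*}C$ infer $(\Gamma;\Delta,A\mathbin{ -\!\!<}B)\vdash^{*}C$. The height of a derivation is the greatest number of successive rule applications in it, zero-premise rules having height 0. -}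

module Defs where

open import Data.Nat using (ℕ; zero; suc; _⊔_; _≤_)
open import Data.List using (List; []; _∷_)
open import Data.List.Relation.Binary.Permutation.Propositional using (_↭_)
open import Data.Product using (∃; _×_)

infixr 6 _∧_
infixr 5 _∨_
infixr 4 _⇒_ _-<_
data Fm : Set where
  at  : ℕ → Fm
  ⊥'  : Fm
  ⊤'  : Fm
  _∧_ : Fm → Fm → Fm
  _∨_ : Fm → Fm → Fm
  _⇒_ : Fm → Fm → Fm
  _-<_ : Fm → Fm → Fm

-- Polarity of the sequent arrow: + (verification) or - (falsification).
data Pol : Set where
  pos neg : Pol

-- Multisets of formulas are represented as lists taken up to permutation:
-- every rule's conclusion context is any list that is a permutation of
-- "principal formula(s) ∷ side context".
Ctx : Set
Ctx = List Fm

-- Der Γ Δ s C h : the sequent (Γ; Δ) ⊢^s C has a derivation of height h.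
data Der : Ctx → Ctx → Pol → Fm → ℕ → Set where
  ax⁺ : ∀ {Γ Γ' Δ p} → Γ' ↭ (at p ∷ Γ) → Der Γ' Δ pos (at p) 0
  ax⁻ : ∀ {Γ Δ Δ' p} → Δ' ↭ (at p ∷ Δ) → Der Γ Δ' neg (at p) 0
  ⊥L  : ∀ {Γ Γ' Δ s C} → Γ' ↭ (⊥' ∷ Γ) → Der Γ' Δ s C 0
  ⊤L  : ∀ {Γ Δ Δ' s C} → Δ' ↭ (⊤' ∷ Δ) → Der Γ Δ' s C 0
  ⊥R⁻ : ∀ {Γ Δ} → Der Γ Δ neg ⊥' 0
  ⊤R⁺ : ∀ {Γ Δ} → Der Γ Δ pos ⊤' 0
  ∧R⁺  : ∀ {Γ Δ A B m n} → Der Γ Δ pos A m → Der Γ Δ pos B n → Der Γ Δ pos (A ∧ B) (suc (m ⊔ n))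
  ∧R⁻₁ : ∀ {Γ Δ A B m} → Der Γ Δ neg A m → Der Γ Δ neg (A ∧ B) (suc m)
  ∧R⁻₂ : ∀ {Γ Δ A B m} → Der Γ Δ neg B m → Der Γ Δ neg (A ∧ B) (suc m)
  ∧La  : ∀ {Γ Γ' Δ s C A B m} → Γ' ↭ ((A ∧ B) ∷ Γ) → Der (A ∷ B ∷ Γ) Δ s C m → Der Γ' Δ s C (suc m)
  ∧Lc  : ∀ {Γ Δ Δ' s C A B m n} → Δ' ↭ ((A ∧ B) ∷ Δ) → Der Γ (A ∷ Δ) s C m → Der Γ (B ∷ Δ) s C n → Der Γ Δ' s C (suc (m ⊔ n))
  ∨R⁺₁ : ∀ {Γ Δ A B m} → Der Γ Δ pos A m → Der Γ Δ pos (A ∨ B) (suc m)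
  ∨R⁺₂ : ∀ {Γ Δ A B m} → Der Γ Δ pos B m → Der Γ Δ pos (A ∨ B) (suc m)
  ∨R⁻  : ∀ {Γ Δ A B m n} → Der Γ Δ neg A m → Der Γ Δ neg B n → Der Γ Δ neg (A ∨ B) (suc (m ⊔ n))
  ∨La  : ∀ {Γ Γ' Δ s C A B m n} → Γ' ↭ ((A ∨ B) ∷ Γ) → Der (A ∷ Γ) Δ s C m → Der (B ∷ Γ) Δ s C n → Der Γ' Δ s C (suc (m ⊔ n))
  ∨Lc  : ∀ {Γ Δ Δ' s C A B m} → Δ' ↭ ((A ∨ B) ∷ Δ) → Der Γ (A ∷ B ∷ Δ) s C m → Der Γ Δ' s C (suc m)
  ⇒R⁺ : ∀ {Γ Δ A B m} → Der (A ∷ Γ) Δ pos B m → Der Γ Δ pos (A ⇒ B) (suc m)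
  ⇒R⁻ : ∀ {Γ Δ A B m n} → Der Γ Δ pos A m → Der Γ Δ neg B n → Der Γ Δ neg (A ⇒ B) (suc (m ⊔ n))
  ⇒La : ∀ {Γ Γ' Δ s C A B m n} → Γ' ↭ ((A ⇒ B) ∷ Γ) → Der Γ' Δ pos A m → Der (B ∷ Γ) Δ s C n → Der Γ' Δ s C (suc (m ⊔ n))
  ⇒Lc : ∀ {Γ Δ Δ' s C A B m} → Δ' ↭ ((A ⇒ B) ∷ Δ) → Der (A ∷ Γ) (B ∷ Δ) s C m → Der Γ Δ' s C (suc m)
  -<R⁺ : ∀ {Γ Δ A B m n} → Der Γ Δ pos A m → Der Γ Δ neg B n → Der Γ Δ pos (A -< B) (suc (m ⊔ n))
  -<R⁻ : ∀ {Γ Δ A B m} → Der Γ (B ∷ Δ) neg A m → Der Γ Δ neg (A -< B) (suc m)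
  -<La : ∀ {Γ Γ' Δ s C A B m} → Γ' ↭ ((A -< B) ∷ Γ) → Der (A ∷ Γ) (B ∷ Δ) s C m → Der Γ' Δ s C (suc m)
  -<Lc : ∀ {Γ Δ Δ' s C A B m n} → Δ' ↭ ((A -< B) ∷ Δ) → Der Γ Δ' neg B m → Der Γ (A ∷ Δ) s C n → Der Γ Δ' s C (suc (m ⊔ n))

_⨾_⊢[_]_≤h_ : Ctx → Ctx → Pol → Fm → ℕ → Set
Γ ⨾ Δ ⊢[ s ] C ≤h n = ∃ λ h → Der Γ Δ s C h × h ≤ n

-- Contraction is proved by induction on the height bound, for assumptions and
-- counterassumptions simultaneously. If neither copy of D is principal in the last
-- rule, the induction hypothesis applies to the premises. If one copy is principal,
-- the other copy is taken apart in the premises by height-preserving inversion of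
-- the same rule, and the duplicated components are contracted by the induction
-- hypothesis; ⇒Lc and -<La move a component to the other side, which is why both
-- contractions are proved together. The left premises of ⇒La and -<Lc keep the
-- principal formula and are contracted directly, so only their right premises
-- need to be invertible.

module Submission where

open import Defs
open import Data.Nat using (ℕ; suc; _⊔_; _≤_; z≤n; s≤s)
open import Data.Nat.Properties using (m⊔n≤o⇒m≤o; m⊔n≤o⇒n≤o; ⊔-lub; m≤n⇒m≤1+n)
open import Data.Empty using (⊥-elim)
open import Data.List using ([]; _∷_; _++_; [_])
open import Data.List.Membership.Propositional using (_∈_)
open import Data.List.Membership.Propositional.Properties using (∈-∃++)
open import Data.List.Relation.Unary.Any using (here; there)
open import Data.List.Relation.Binary.Permutation.Propositional
open import Data.List.Relation.Binary.Permutation.Propositional.Properties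
  using (∈-resp-↭; drop-∷; shift; shifts; ++⁺ˡ)
open import Data.Product using (∃; _×_; _,_)
open import Data.Sum using (_⊎_; inj₁; inj₂)
open import Relation.Binary.PropositionalEquality using (_≡_; _≢_; refl)

module _ {a} {E : Set a} where

  ∈⇒↭∷ : ∀ {x : E} {xs} → x ∈ xs → ∃ λ ys → xs ↭ x ∷ ys
  ∈⇒↭∷ x∈xs with ys , zs , refl ← ∈-∃++ x∈xs = ys ++ zs , shift _ ys zs

  ∷-↭-∷-cases : ∀ {x y : E} {xs ys} → x ∷ xs ↭ y ∷ ys →
                (x ≡ y × xs ↭ ys) ⊎ ∃ λ zs → ys ↭ x ∷ zs × xs ↭ y ∷ zs
  ∷-↭-∷-cases p with ∈-resp-↭ p (here refl)
  ... | here refl = inj₁ (refl , drop-∷ p)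
  ... | there x∈ys with zs , ys↭ ← ∈⇒↭∷ x∈ys =
    inj₂ (zs , ys↭ , drop-∷ (trans p (trans (prep _ ys↭) (swap _ _ ↭-refl))))

  ∷-↭-∷∷-cases : ∀ {x y : E} {xs ys} → x ∷ xs ↭ y ∷ y ∷ ys →
                 (x ≡ y × xs ↭ y ∷ ys) ⊎ ∃ λ zs → ys ↭ x ∷ zs × xs ↭ y ∷ y ∷ zs
  ∷-↭-∷∷-cases p with ∷-↭-∷-cases p
  ... | inj₁ x≡y,xs↭ = inj₁ x≡y,xs↭
  ... | inj₂ (zs , yys↭ , xs↭) with ∷-↭-∷-cases yys↭
  ...   | inj₁ (refl , ys↭zs) = inj₁ (refl , trans xs↭ (prep _ (↭-sym ys↭zs)))
  ...   | inj₂ (ws , zs↭ , ys↭) = inj₂ (ws , ys↭ , trans xs↭ (prep _ zs↭))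

  ++⁺ˡ-∷ : ∀ zs {x : E} {xs ys} → xs ↭ x ∷ ys → zs ++ xs ↭ x ∷ zs ++ ys
  ++⁺ˡ-∷ zs p = trans (++⁺ˡ zs p) (shift _ zs _)

  ++⁺ˡ-∷∷ : ∀ zs {x : E} {xs ys} → xs ↭ x ∷ x ∷ ys → zs ++ xs ↭ x ∷ x ∷ zs ++ ys
  ++⁺ˡ-∷∷ zs p = trans (++⁺ˡ-∷ zs p) (prep _ (shift _ zs _))

  unshift : ∀ zs {x : E} {ys} → x ∷ zs ++ ys ↭ zs ++ x ∷ ys
  unshift zs = ↭-sym (shift _ zs _)

variable
  Γ Γ' Γ₁ Γ₂ Δ Δ' Δ₁ Δ₂ : Ctx
  s s₁ s₂ : Pol
  C C₁ C₂ D : Fm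
  h m k n : ℕ

exchange : Γ ↭ Γ' → Δ ↭ Δ' → Der Γ Δ s C h → Der Γ' Δ' s C h
exchange γ δ (ax⁺ p)       = ax⁺ (trans (↭-sym γ) p)
exchange γ δ (ax⁻ p)       = ax⁻ (trans (↭-sym δ) p)
exchange γ δ (⊥L p)        = ⊥L (trans (↭-sym γ) p)
exchange γ δ (⊤L p)        = ⊤L (trans (↭-sym δ) p)
exchange γ δ ⊥R⁻           = ⊥R⁻
exchange γ δ ⊤R⁺           = ⊤R⁺
exchange γ δ (∧R⁺ d e)     = ∧R⁺ (exchange γ δ d) (exchange γ δ e)
exchange γ δ (∧R⁻₁ d)      = ∧R⁻₁ (exchange γ δ d)
exchange γ δ (∧R⁻₂ d)      = ∧R⁻₂ (exchange γ δ d)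
exchange γ δ (∧La p d)     = ∧La (trans (↭-sym γ) p) (exchange ↭-refl δ d)
exchange γ δ (∧Lc p d e)   = ∧Lc (trans (↭-sym δ) p) (exchange γ ↭-refl d) (exchange γ ↭-refl e)
exchange γ δ (∨R⁺₁ d)      = ∨R⁺₁ (exchange γ δ d)
exchange γ δ (∨R⁺₂ d)      = ∨R⁺₂ (exchange γ δ d)
exchange γ δ (∨R⁻ d e)     = ∨R⁻ (exchange γ δ d) (exchange γ δ e)
exchange γ δ (∨La p d e)   = ∨La (trans (↭-sym γ) p) (exchange ↭-refl δ d) (exchange ↭-refl δ e)
exchange γ δ (∨Lc p d)     = ∨Lc (trans (↭-sym δ) p) (exchange γ ↭-refl d)
exchange γ δ (⇒R⁺ d)       = ⇒R⁺ (exchange (prep _ γ) δ d)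
exchange γ δ (⇒R⁻ d e)     = ⇒R⁻ (exchange γ δ d) (exchange γ δ e)
exchange γ δ (⇒La p d e)   = ⇒La (trans (↭-sym γ) p) (exchange γ δ d) (exchange ↭-refl δ e)
exchange γ δ (⇒Lc p d)     = ⇒Lc (trans (↭-sym δ) p) (exchange (prep _ γ) ↭-refl d)
exchange γ δ (-<R⁺ d e)    = -<R⁺ (exchange γ δ d) (exchange γ δ e)
exchange γ δ (-<R⁻ d)      = -<R⁻ (exchange γ (prep _ δ) d)
exchange γ δ (-<La p d)    = -<La (trans (↭-sym γ) p) (exchange ↭-refl (prep _ δ) d)
exchange γ δ (-<Lc p d e)  = -<Lc (trans (↭-sym δ) p) (exchange γ δ d) (exchange γ ↭-refl e)

≤h-exchange : Γ ↭ Γ' → Δ ↭ Δ' → Γ ⨾ Δ ⊢[ s ] C ≤h n → Γ' ⨾ Δ' ⊢[ s ] C ≤h n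
≤h-exchange γ δ (h , d , le) = h , exchange γ δ d , le

≤h-suc : Γ ⨾ Δ ⊢[ s ] C ≤h n → Γ ⨾ Δ ⊢[ s ] C ≤h suc n
≤h-suc (h , d , le) = h , d , m≤n⇒m≤1+n le

leaf : Der Γ Δ s C 0 → Γ ⨾ Δ ⊢[ s ] C ≤h n
leaf d = 0 , d , z≤n

infer₁ : (∀ {h} → Der Γ₁ Δ₁ s₁ C₁ h → Der Γ Δ s C (suc h)) →
         Γ₁ ⨾ Δ₁ ⊢[ s₁ ] C₁ ≤h n → Γ ⨾ Δ ⊢[ s ] C ≤h suc n
infer₁ rule (h , d , le) = suc h , rule d , s≤s le

infer₂ : (∀ {h k} → Der Γ₁ Δ₁ s₁ C₁ h → Der Γ₂ Δ₂ s₂ C₂ k → Der Γ Δ s C (suc (h ⊔ k))) →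
         Γ₁ ⨾ Δ₁ ⊢[ s₁ ] C₁ ≤h n → Γ₂ ⨾ Δ₂ ⊢[ s₂ ] C₂ ≤h n → Γ ⨾ Δ ⊢[ s ] C ≤h suc n
infer₂ rule (h , d , le) (k , e , le′) = suc (h ⊔ k) , rule d e , s≤s (⊔-lub le le′)

⊔≤ˡ : m ⊔ k ≤ n → m ≤ n
⊔≤ˡ {m} {k} = m⊔n≤o⇒m≤o m k

⊔≤ʳ : m ⊔ k ≤ n → k ≤ n
⊔≤ʳ {m} {k} = m⊔n≤o⇒n≤o m k

-- The rules with principal X already yield the inverted sequent from their premises;
-- invertˡ lifts this to arbitrary derivations.
record AssumptionInversion (X : Fm) (P Q : Ctx) : Set where
  field
    atom≢      : ∀ {p} → at p ≢ X
    ⊥≢         : ⊥' ≢ X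
    ∧-premise  : ∀ {A B} → (A ∧ B) ≡ X →
                 (A ∷ B ∷ Γ) ⨾ Δ ⊢[ s ] C ≤h n → (P ++ Γ) ⨾ (Q ++ Δ) ⊢[ s ] C ≤h n
    ∨-premises : ∀ {A B} → (A ∨ B) ≡ X →
                 (A ∷ Γ) ⨾ Δ ⊢[ s ] C ≤h n → (B ∷ Γ) ⨾ Δ ⊢[ s ] C ≤h n →
                 (P ++ Γ) ⨾ (Q ++ Δ) ⊢[ s ] C ≤h n
    ⇒-premise  : ∀ {A B} → (A ⇒ B) ≡ X →
                 (B ∷ Γ) ⨾ Δ ⊢[ s ] C ≤h n → (P ++ Γ) ⨾ (Q ++ Δ) ⊢[ s ] C ≤h n
    -<-premise : ∀ {A B} → (A -< B) ≡ X →
                 (A ∷ Γ) ⨾ (B ∷ Δ) ⊢[ s ] C ≤h n → (P ++ Γ) ⨾ (Q ++ Δ) ⊢[ s ] C ≤h n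

module _ {X P Q} (H : AssumptionInversion X P Q) where
  open AssumptionInversion H

  invertˡ : Γ' ↭ X ∷ Γ → Γ' ⨾ Δ ⊢[ s ] C ≤h n → (P ++ Γ) ⨾ (Q ++ Δ) ⊢[ s ] C ≤h n
  invertˡ q (_ , ax⁺ p , _) with ∷-↭-∷-cases (trans (↭-sym p) q)
  ... | inj₁ (e , _)      = ⊥-elim (atom≢ e)
  ... | inj₂ (_ , r₀ , _) = leaf (ax⁺ (++⁺ˡ-∷ P r₀))
  invertˡ q (_ , ax⁻ p , _) = leaf (ax⁻ (++⁺ˡ-∷ Q p))
  invertˡ q (_ , ⊥L p , _) with ∷-↭-∷-cases (trans (↭-sym p) q)
  ... | inj₁ (e , _)      = ⊥-elim (⊥≢ e)
  ... | inj₂ (_ , r₀ , _) = leaf (⊥L (++⁺ˡ-∷ P r₀))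
  invertˡ q (_ , ⊤L p , _) = leaf (⊤L (++⁺ˡ-∷ Q p))
  invertˡ q (_ , ⊥R⁻ , _) = leaf ⊥R⁻
  invertˡ q (_ , ⊤R⁺ , _) = leaf ⊤R⁺
  invertˡ q (_ , ∧R⁺ d e , s≤s le) = infer₂ ∧R⁺ (invertˡ q (_ , d , ⊔≤ˡ le)) (invertˡ q (_ , e , ⊔≤ʳ le))
  invertˡ q (_ , ∧R⁻₁ d , s≤s le) = infer₁ ∧R⁻₁ (invertˡ q (_ , d , le))
  invertˡ q (_ , ∧R⁻₂ d , s≤s le) = infer₁ ∧R⁻₂ (invertˡ q (_ , d , le))
  invertˡ q (_ , ∧La {A = A} {B = B} p d , s≤s le) with ∷-↭-∷-cases (trans (↭-sym p) q)
  ... | inj₁ (e , r) = ≤h-suc (≤h-exchange (++⁺ˡ P r) ↭-refl (∧-premise e (_ , d , le)))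
  ... | inj₂ (_ , r₀ , r) =
    infer₁ (∧La (++⁺ˡ-∷ P r₀))
      (≤h-exchange (shifts P (A ∷ B ∷ [])) ↭-refl (invertˡ (++⁺ˡ-∷ (A ∷ B ∷ []) r) (_ , d , le)))
  invertˡ q (_ , ∧Lc {A = A} {B = B} p d e , s≤s le) =
    infer₂ (∧Lc (++⁺ˡ-∷ Q p))
      (≤h-exchange ↭-refl (shifts Q [ A ]) (invertˡ q (_ , d , ⊔≤ˡ le)))
      (≤h-exchange ↭-refl (shifts Q [ B ]) (invertˡ q (_ , e , ⊔≤ʳ le)))
  invertˡ q (_ , ∨R⁺₁ d , s≤s le) = infer₁ ∨R⁺₁ (invertˡ q (_ , d , le))
  invertˡ q (_ , ∨R⁺₂ d , s≤s le) = infer₁ ∨R⁺₂ (invertˡ q (_ , d , le))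
  invertˡ q (_ , ∨R⁻ d e , s≤s le) = infer₂ ∨R⁻ (invertˡ q (_ , d , ⊔≤ˡ le)) (invertˡ q (_ , e , ⊔≤ʳ le))
  invertˡ q (_ , ∨La {A = A} {B = B} p d e , s≤s le) with ∷-↭-∷-cases (trans (↭-sym p) q)
  ... | inj₁ (eq , r) =
    ≤h-suc (≤h-exchange (++⁺ˡ P r) ↭-refl (∨-premises eq (_ , d , ⊔≤ˡ le) (_ , e , ⊔≤ʳ le)))
  ... | inj₂ (_ , r₀ , r) =
    infer₂ (∨La (++⁺ˡ-∷ P r₀))
      (≤h-exchange (shifts P [ A ]) ↭-refl (invertˡ (++⁺ˡ-∷ [ A ] r) (_ , d , ⊔≤ˡ le)))
      (≤h-exchange (shifts P [ B ]) ↭-refl (invertˡ (++⁺ˡ-∷ [ B ] r) (_ , e , ⊔≤ʳ le)))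
  invertˡ q (_ , ∨Lc {A = A} {B = B} p d , s≤s le) =
    infer₁ (∨Lc (++⁺ˡ-∷ Q p)) (≤h-exchange ↭-refl (shifts Q (A ∷ B ∷ [])) (invertˡ q (_ , d , le)))
  invertˡ q (_ , ⇒R⁺ {A = A} d , s≤s le) =
    infer₁ ⇒R⁺ (≤h-exchange (shifts P [ A ]) ↭-refl (invertˡ (++⁺ˡ-∷ [ A ] q) (_ , d , le)))
  invertˡ q (_ , ⇒R⁻ d e , s≤s le) = infer₂ ⇒R⁻ (invertˡ q (_ , d , ⊔≤ˡ le)) (invertˡ q (_ , e , ⊔≤ʳ le))
  invertˡ q (_ , ⇒La {B = B} p d e , s≤s le) with ∷-↭-∷-cases (trans (↭-sym p) q)
  ... | inj₁ (eq , r) = ≤h-suc (≤h-exchange (++⁺ˡ P r) ↭-refl (⇒-premise eq (_ , e , ⊔≤ʳ le)))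
  ... | inj₂ (_ , r₀ , r) =
    infer₂ (⇒La (++⁺ˡ-∷ P r₀))
      (invertˡ q (_ , d , ⊔≤ˡ le))
      (≤h-exchange (shifts P [ B ]) ↭-refl (invertˡ (++⁺ˡ-∷ [ B ] r) (_ , e , ⊔≤ʳ le)))
  invertˡ q (_ , ⇒Lc {A = A} {B = B} p d , s≤s le) =
    infer₁ (⇒Lc (++⁺ˡ-∷ Q p))
      (≤h-exchange (shifts P [ A ]) (shifts Q [ B ]) (invertˡ (++⁺ˡ-∷ [ A ] q) (_ , d , le)))
  invertˡ q (_ , -<R⁺ d e , s≤s le) =
    infer₂ -<R⁺ (invertˡ q (_ , d , ⊔≤ˡ le)) (invertˡ q (_ , e , ⊔≤ʳ le))
  invertˡ q (_ , -<R⁻ {B = B} d , s≤s le) =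
    infer₁ -<R⁻ (≤h-exchange ↭-refl (shifts Q [ B ]) (invertˡ q (_ , d , le)))
  invertˡ q (_ , -<La {A = A} {B = B} p d , s≤s le) with ∷-↭-∷-cases (trans (↭-sym p) q)
  ... | inj₁ (e , r) = ≤h-suc (≤h-exchange (++⁺ˡ P r) ↭-refl (-<-premise e (_ , d , le)))
  ... | inj₂ (_ , r₀ , r) =
    infer₁ (-<La (++⁺ˡ-∷ P r₀))
      (≤h-exchange (shifts P [ A ]) (shifts Q [ B ]) (invertˡ (++⁺ˡ-∷ [ A ] r) (_ , d , le)))
  invertˡ q (_ , -<Lc {A = A} p d e , s≤s le) =
    infer₂ (-<Lc (++⁺ˡ-∷ Q p))
      (invertˡ q (_ , d , ⊔≤ˡ le))
      (≤h-exchange ↭-refl (shifts Q [ A ]) (invertˡ q (_ , e , ⊔≤ʳ le)))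

record CounterassumptionInversion (X : Fm) (P Q : Ctx) : Set where
  field
    atom≢      : ∀ {p} → at p ≢ X
    ⊤≢         : ⊤' ≢ X
    ∧-premises : ∀ {A B} → (A ∧ B) ≡ X →
                 Γ ⨾ (A ∷ Δ) ⊢[ s ] C ≤h n → Γ ⨾ (B ∷ Δ) ⊢[ s ] C ≤h n →
                 (P ++ Γ) ⨾ (Q ++ Δ) ⊢[ s ] C ≤h n
    ∨-premise  : ∀ {A B} → (A ∨ B) ≡ X →
                 Γ ⨾ (A ∷ B ∷ Δ) ⊢[ s ] C ≤h n → (P ++ Γ) ⨾ (Q ++ Δ) ⊢[ s ] C ≤h n
    ⇒-premise  : ∀ {A B} → (A ⇒ B) ≡ X →
                 (A ∷ Γ) ⨾ (B ∷ Δ) ⊢[ s ] C ≤h n → (P ++ Γ) ⨾ (Q ++ Δ) ⊢[ s ] C ≤h n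
    -<-premise : ∀ {A B} → (A -< B) ≡ X →
                 Γ ⨾ (A ∷ Δ) ⊢[ s ] C ≤h n → (P ++ Γ) ⨾ (Q ++ Δ) ⊢[ s ] C ≤h n

module _ {X P Q} (H : CounterassumptionInversion X P Q) where
  open CounterassumptionInversion H

  invertʳ : Δ' ↭ X ∷ Δ → Γ ⨾ Δ' ⊢[ s ] C ≤h n → (P ++ Γ) ⨾ (Q ++ Δ) ⊢[ s ] C ≤h n
  invertʳ q (_ , ax⁺ p , _) = leaf (ax⁺ (++⁺ˡ-∷ P p))
  invertʳ q (_ , ax⁻ p , _) with ∷-↭-∷-cases (trans (↭-sym p) q)
  ... | inj₁ (e , _)      = ⊥-elim (atom≢ e)
  ... | inj₂ (_ , r₀ , _) = leaf (ax⁻ (++⁺ˡ-∷ Q r₀))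
  invertʳ q (_ , ⊥L p , _) = leaf (⊥L (++⁺ˡ-∷ P p))
  invertʳ q (_ , ⊤L p , _) with ∷-↭-∷-cases (trans (↭-sym p) q)
  ... | inj₁ (e , _)      = ⊥-elim (⊤≢ e)
  ... | inj₂ (_ , r₀ , _) = leaf (⊤L (++⁺ˡ-∷ Q r₀))
  invertʳ q (_ , ⊥R⁻ , _) = leaf ⊥R⁻
  invertʳ q (_ , ⊤R⁺ , _) = leaf ⊤R⁺
  invertʳ q (_ , ∧R⁺ d e , s≤s le) = infer₂ ∧R⁺ (invertʳ q (_ , d , ⊔≤ˡ le)) (invertʳ q (_ , e , ⊔≤ʳ le))
  invertʳ q (_ , ∧R⁻₁ d , s≤s le) = infer₁ ∧R⁻₁ (invertʳ q (_ , d , le))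
  invertʳ q (_ , ∧R⁻₂ d , s≤s le) = infer₁ ∧R⁻₂ (invertʳ q (_ , d , le))
  invertʳ q (_ , ∧La {A = A} {B = B} p d , s≤s le) =
    infer₁ (∧La (++⁺ˡ-∷ P p)) (≤h-exchange (shifts P (A ∷ B ∷ [])) ↭-refl (invertʳ q (_ , d , le)))
  invertʳ q (_ , ∧Lc {A = A} {B = B} p d e , s≤s le) with ∷-↭-∷-cases (trans (↭-sym p) q)
  ... | inj₁ (eq , r) =
    ≤h-suc (≤h-exchange ↭-refl (++⁺ˡ Q r) (∧-premises eq (_ , d , ⊔≤ˡ le) (_ , e , ⊔≤ʳ le)))
  ... | inj₂ (_ , r₀ , r) =
    infer₂ (∧Lc (++⁺ˡ-∷ Q r₀))
      (≤h-exchange ↭-refl (shifts Q [ A ]) (invertʳ (++⁺ˡ-∷ [ A ] r) (_ , d , ⊔≤ˡ le)))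
      (≤h-exchange ↭-refl (shifts Q [ B ]) (invertʳ (++⁺ˡ-∷ [ B ] r) (_ , e , ⊔≤ʳ le)))
  invertʳ q (_ , ∨R⁺₁ d , s≤s le) = infer₁ ∨R⁺₁ (invertʳ q (_ , d , le))
  invertʳ q (_ , ∨R⁺₂ d , s≤s le) = infer₁ ∨R⁺₂ (invertʳ q (_ , d , le))
  invertʳ q (_ , ∨R⁻ d e , s≤s le) = infer₂ ∨R⁻ (invertʳ q (_ , d , ⊔≤ˡ le)) (invertʳ q (_ , e , ⊔≤ʳ le))
  invertʳ q (_ , ∨La {A = A} {B = B} p d e , s≤s le) =
    infer₂ (∨La (++⁺ˡ-∷ P p))
      (≤h-exchange (shifts P [ A ]) ↭-refl (invertʳ q (_ , d , ⊔≤ˡ le)))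
      (≤h-exchange (shifts P [ B ]) ↭-refl (invertʳ q (_ , e , ⊔≤ʳ le)))
  invertʳ q (_ , ∨Lc {A = A} {B = B} p d , s≤s le) with ∷-↭-∷-cases (trans (↭-sym p) q)
  ... | inj₁ (e , r) = ≤h-suc (≤h-exchange ↭-refl (++⁺ˡ Q r) (∨-premise e (_ , d , le)))
  ... | inj₂ (_ , r₀ , r) =
    infer₁ (∨Lc (++⁺ˡ-∷ Q r₀))
      (≤h-exchange ↭-refl (shifts Q (A ∷ B ∷ [])) (invertʳ (++⁺ˡ-∷ (A ∷ B ∷ []) r) (_ , d , le)))
  invertʳ q (_ , ⇒R⁺ {A = A} d , s≤s le) =
    infer₁ ⇒R⁺ (≤h-exchange (shifts P [ A ]) ↭-refl (invertʳ q (_ , d , le)))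
  invertʳ q (_ , ⇒R⁻ d e , s≤s le) = infer₂ ⇒R⁻ (invertʳ q (_ , d , ⊔≤ˡ le)) (invertʳ q (_ , e , ⊔≤ʳ le))
  invertʳ q (_ , ⇒La {B = B} p d e , s≤s le) =
    infer₂ (⇒La (++⁺ˡ-∷ P p))
      (invertʳ q (_ , d , ⊔≤ˡ le))
      (≤h-exchange (shifts P [ B ]) ↭-refl (invertʳ q (_ , e , ⊔≤ʳ le)))
  invertʳ q (_ , ⇒Lc {A = A} {B = B} p d , s≤s le) with ∷-↭-∷-cases (trans (↭-sym p) q)
  ... | inj₁ (e , r) = ≤h-suc (≤h-exchange ↭-refl (++⁺ˡ Q r) (⇒-premise e (_ , d , le)))
  ... | inj₂ (_ , r₀ , r) =
    infer₁ (⇒Lc (++⁺ˡ-∷ Q r₀))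
      (≤h-exchange (shifts P [ A ]) (shifts Q [ B ]) (invertʳ (++⁺ˡ-∷ [ B ] r) (_ , d , le)))
  invertʳ q (_ , -<R⁺ d e , s≤s le) =
    infer₂ -<R⁺ (invertʳ q (_ , d , ⊔≤ˡ le)) (invertʳ q (_ , e , ⊔≤ʳ le))
  invertʳ q (_ , -<R⁻ {B = B} d , s≤s le) =
    infer₁ -<R⁻ (≤h-exchange ↭-refl (shifts Q [ B ]) (invertʳ (++⁺ˡ-∷ [ B ] q) (_ , d , le)))
  invertʳ q (_ , -<La {A = A} {B = B} p d , s≤s le) =
    infer₁ (-<La (++⁺ˡ-∷ P p))
      (≤h-exchange (shifts P [ A ]) (shifts Q [ B ]) (invertʳ (++⁺ˡ-∷ [ B ] q) (_ , d , le)))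
  invertʳ q (_ , -<Lc {A = A} p d e , s≤s le) with ∷-↭-∷-cases (trans (↭-sym p) q)
  ... | inj₁ (eq , r) = ≤h-suc (≤h-exchange ↭-refl (++⁺ˡ Q r) (-<-premise eq (_ , e , ⊔≤ʳ le)))
  ... | inj₂ (_ , r₀ , r) =
    infer₂ (-<Lc (++⁺ˡ-∷ Q r₀))
      (invertʳ q (_ , d , ⊔≤ˡ le))
      (≤h-exchange ↭-refl (shifts Q [ A ]) (invertʳ (++⁺ˡ-∷ [ A ] r) (_ , e , ⊔≤ʳ le)))

∧La-inversion : ∀ {A B} → AssumptionInversion (A ∧ B) (A ∷ B ∷ []) []
∧La-inversion = record
  { atom≢ = λ () ; ⊥≢ = λ () ; ∧-premise = λ { refl d → d }
  ; ∨-premises = λ () ; ⇒-premise = λ () ; -<-premise = λ () }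

∨La-inversion₁ : ∀ {A B} → AssumptionInversion (A ∨ B) [ A ] []
∨La-inversion₁ = record
  { atom≢ = λ () ; ⊥≢ = λ () ; ∧-premise = λ ()
  ; ∨-premises = λ { refl d _ → d } ; ⇒-premise = λ () ; -<-premise = λ () }

∨La-inversion₂ : ∀ {A B} → AssumptionInversion (A ∨ B) [ B ] []
∨La-inversion₂ = record
  { atom≢ = λ () ; ⊥≢ = λ () ; ∧-premise = λ ()
  ; ∨-premises = λ { refl _ e → e } ; ⇒-premise = λ () ; -<-premise = λ () }

⇒La-inversion : ∀ {A B} → AssumptionInversion (A ⇒ B) [ B ] []
⇒La-inversion = record
  { atom≢ = λ () ; ⊥≢ = λ () ; ∧-premise = λ ()
  ; ∨-premises = λ () ; ⇒-premise = λ { refl e → e } ; -<-premise = λ () }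

-<La-inversion : ∀ {A B} → AssumptionInversion (A -< B) [ A ] [ B ]
-<La-inversion = record
  { atom≢ = λ () ; ⊥≢ = λ () ; ∧-premise = λ ()
  ; ∨-premises = λ () ; ⇒-premise = λ () ; -<-premise = λ { refl d → d } }

∧Lc-inversion₁ : ∀ {A B} → CounterassumptionInversion (A ∧ B) [] [ A ]
∧Lc-inversion₁ = record
  { atom≢ = λ () ; ⊤≢ = λ () ; ∧-premises = λ { refl d _ → d }
  ; ∨-premise = λ () ; ⇒-premise = λ () ; -<-premise = λ () }

∧Lc-inversion₂ : ∀ {A B} → CounterassumptionInversion (A ∧ B) [] [ B ]
∧Lc-inversion₂ = record
  { atom≢ = λ () ; ⊤≢ = λ () ; ∧-premises = λ { refl _ e → e }
  ; ∨-premise = λ () ; ⇒-premise = λ () ; -<-premise = λ () }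

∨Lc-inversion : ∀ {A B} → CounterassumptionInversion (A ∨ B) [] (A ∷ B ∷ [])
∨Lc-inversion = record
  { atom≢ = λ () ; ⊤≢ = λ () ; ∧-premises = λ ()
  ; ∨-premise = λ { refl d → d } ; ⇒-premise = λ () ; -<-premise = λ () }

⇒Lc-inversion : ∀ {A B} → CounterassumptionInversion (A ⇒ B) [ A ] [ B ]
⇒Lc-inversion = record
  { atom≢ = λ () ; ⊤≢ = λ () ; ∧-premises = λ ()
  ; ∨-premise = λ () ; ⇒-premise = λ { refl d → d } ; -<-premise = λ () }

-<Lc-inversion : ∀ {A B} → CounterassumptionInversion (A -< B) [] [ A ]
-<Lc-inversion = record
  { atom≢ = λ () ; ⊤≢ = λ () ; ∧-premises = λ ()
  ; ∨-premise = λ () ; ⇒-premise = λ () ; -<-premise = λ { refl e → e } }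

contractionˡ : Γ' ↭ D ∷ D ∷ Γ → Γ' ⨾ Δ ⊢[ s ] C ≤h n → (D ∷ Γ) ⨾ Δ ⊢[ s ] C ≤h n
contractionʳ : Δ' ↭ D ∷ D ∷ Δ → Γ ⨾ Δ' ⊢[ s ] C ≤h n → Γ ⨾ (D ∷ Δ) ⊢[ s ] C ≤h n

contractionˡ q (_ , ax⁺ p , _) with ∷-↭-∷∷-cases (trans (↭-sym p) q)
... | inj₁ (refl , _)   = leaf (ax⁺ ↭-refl)
... | inj₂ (_ , r₀ , _) = leaf (ax⁺ (++⁺ˡ-∷ [ _ ] r₀))
contractionˡ q (_ , ax⁻ p , _) = leaf (ax⁻ p)
contractionˡ q (_ , ⊥L p , _) with ∷-↭-∷∷-cases (trans (↭-sym p) q)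
... | inj₁ (refl , _)   = leaf (⊥L ↭-refl)
... | inj₂ (_ , r₀ , _) = leaf (⊥L (++⁺ˡ-∷ [ _ ] r₀))
contractionˡ q (_ , ⊤L p , _) = leaf (⊤L p)
contractionˡ q (_ , ⊥R⁻ , _) = leaf ⊥R⁻
contractionˡ q (_ , ⊤R⁺ , _) = leaf ⊤R⁺
contractionˡ q (_ , ∧R⁺ d e , s≤s le) =
  infer₂ ∧R⁺ (contractionˡ q (_ , d , ⊔≤ˡ le)) (contractionˡ q (_ , e , ⊔≤ʳ le))
contractionˡ q (_ , ∧R⁻₁ d , s≤s le) = infer₁ ∧R⁻₁ (contractionˡ q (_ , d , le))
contractionˡ q (_ , ∧R⁻₂ d , s≤s le) = infer₁ ∧R⁻₂ (contractionˡ q (_ , d , le))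
contractionˡ q (_ , ∧La {A = A} {B = B} p d , s≤s le) with ∷-↭-∷∷-cases (trans (↭-sym p) q)
... | inj₁ (refl , r) =
  infer₁ (∧La ↭-refl) (≤h-exchange (swap B A ↭-refl) ↭-refl
    (contractionˡ (trans (swap A B ↭-refl) (prep B (swap A B ↭-refl)))
      (contractionˡ (prep A (swap B A ↭-refl))
        (invertˡ ∧La-inversion (++⁺ˡ-∷ (A ∷ B ∷ []) r) (_ , d , le)))))
... | inj₂ (_ , r₀ , r) =
  infer₁ (∧La (++⁺ˡ-∷ [ _ ] r₀))
    (≤h-exchange (unshift (A ∷ B ∷ [])) ↭-refl (contractionˡ (++⁺ˡ-∷∷ (A ∷ B ∷ []) r) (_ , d , le)))
contractionˡ q (_ , ∧Lc p d e , s≤s le) =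
  infer₂ (∧Lc p) (contractionˡ q (_ , d , ⊔≤ˡ le)) (contractionˡ q (_ , e , ⊔≤ʳ le))
contractionˡ q (_ , ∨R⁺₁ d , s≤s le) = infer₁ ∨R⁺₁ (contractionˡ q (_ , d , le))
contractionˡ q (_ , ∨R⁺₂ d , s≤s le) = infer₁ ∨R⁺₂ (contractionˡ q (_ , d , le))
contractionˡ q (_ , ∨R⁻ d e , s≤s le) =
  infer₂ ∨R⁻ (contractionˡ q (_ , d , ⊔≤ˡ le)) (contractionˡ q (_ , e , ⊔≤ʳ le))
contractionˡ q (_ , ∨La {A = A} {B = B} p d e , s≤s le) with ∷-↭-∷∷-cases (trans (↭-sym p) q)
... | inj₁ (refl , r) =
  infer₂ (∨La ↭-refl)
    (contractionˡ ↭-refl (invertˡ ∨La-inversion₁ (++⁺ˡ-∷ [ A ] r) (_ , d , ⊔≤ˡ le)))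
    (contractionˡ ↭-refl (invertˡ ∨La-inversion₂ (++⁺ˡ-∷ [ B ] r) (_ , e , ⊔≤ʳ le)))
... | inj₂ (_ , r₀ , r) =
  infer₂ (∨La (++⁺ˡ-∷ [ _ ] r₀))
    (≤h-exchange (unshift [ A ]) ↭-refl (contractionˡ (++⁺ˡ-∷∷ [ A ] r) (_ , d , ⊔≤ˡ le)))
    (≤h-exchange (unshift [ B ]) ↭-refl (contractionˡ (++⁺ˡ-∷∷ [ B ] r) (_ , e , ⊔≤ʳ le)))
contractionˡ q (_ , ∨Lc p d , s≤s le) = infer₁ (∨Lc p) (contractionˡ q (_ , d , le))
contractionˡ q (_ , ⇒R⁺ {A = A} d , s≤s le) =
  infer₁ ⇒R⁺ (≤h-exchange (unshift [ A ]) ↭-refl (contractionˡ (++⁺ˡ-∷∷ [ A ] q) (_ , d , le)))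
contractionˡ q (_ , ⇒R⁻ d e , s≤s le) =
  infer₂ ⇒R⁻ (contractionˡ q (_ , d , ⊔≤ˡ le)) (contractionˡ q (_ , e , ⊔≤ʳ le))
contractionˡ q (_ , ⇒La {B = B} p d e , s≤s le) with ∷-↭-∷∷-cases (trans (↭-sym p) q)
... | inj₁ (refl , r) =
  infer₂ (⇒La ↭-refl)
    (contractionˡ q (_ , d , ⊔≤ˡ le))
    (contractionˡ ↭-refl (invertˡ ⇒La-inversion (++⁺ˡ-∷ [ B ] r) (_ , e , ⊔≤ʳ le)))
... | inj₂ (_ , r₀ , r) =
  infer₂ (⇒La (++⁺ˡ-∷ [ _ ] r₀))
    (contractionˡ q (_ , d , ⊔≤ˡ le))
    (≤h-exchange (unshift [ B ]) ↭-refl (contractionˡ (++⁺ˡ-∷∷ [ B ] r) (_ , e , ⊔≤ʳ le)))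
contractionˡ q (_ , ⇒Lc {A = A} p d , s≤s le) =
  infer₁ (⇒Lc p) (≤h-exchange (unshift [ A ]) ↭-refl (contractionˡ (++⁺ˡ-∷∷ [ A ] q) (_ , d , le)))
contractionˡ q (_ , -<R⁺ d e , s≤s le) =
  infer₂ -<R⁺ (contractionˡ q (_ , d , ⊔≤ˡ le)) (contractionˡ q (_ , e , ⊔≤ʳ le))
contractionˡ q (_ , -<R⁻ d , s≤s le) = infer₁ -<R⁻ (contractionˡ q (_ , d , le))
contractionˡ q (_ , -<La {A = A} p d , s≤s le) with ∷-↭-∷∷-cases (trans (↭-sym p) q)
... | inj₁ (refl , r) =
  infer₁ (-<La ↭-refl)
    (contractionʳ ↭-refl (contractionˡ ↭-refl (invertˡ -<La-inversion (++⁺ˡ-∷ [ A ] r) (_ , d , le))))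
... | inj₂ (_ , r₀ , r) =
  infer₁ (-<La (++⁺ˡ-∷ [ _ ] r₀))
    (≤h-exchange (unshift [ A ]) ↭-refl (contractionˡ (++⁺ˡ-∷∷ [ A ] r) (_ , d , le)))
contractionˡ q (_ , -<Lc p d e , s≤s le) =
  infer₂ (-<Lc p) (contractionˡ q (_ , d , ⊔≤ˡ le)) (contractionˡ q (_ , e , ⊔≤ʳ le))

contractionʳ q (_ , ax⁺ p , _) = leaf (ax⁺ p)
contractionʳ q (_ , ax⁻ p , _) with ∷-↭-∷∷-cases (trans (↭-sym p) q)
... | inj₁ (refl , _)   = leaf (ax⁻ ↭-refl)
... | inj₂ (_ , r₀ , _) = leaf (ax⁻ (++⁺ˡ-∷ [ _ ] r₀))
contractionʳ q (_ , ⊥L p , _) = leaf (⊥L p)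
contractionʳ q (_ , ⊤L p , _) with ∷-↭-∷∷-cases (trans (↭-sym p) q)
... | inj₁ (refl , _)   = leaf (⊤L ↭-refl)
... | inj₂ (_ , r₀ , _) = leaf (⊤L (++⁺ˡ-∷ [ _ ] r₀))
contractionʳ q (_ , ⊥R⁻ , _) = leaf ⊥R⁻
contractionʳ q (_ , ⊤R⁺ , _) = leaf ⊤R⁺
contractionʳ q (_ , ∧R⁺ d e , s≤s le) =
  infer₂ ∧R⁺ (contractionʳ q (_ , d , ⊔≤ˡ le)) (contractionʳ q (_ , e , ⊔≤ʳ le))
contractionʳ q (_ , ∧R⁻₁ d , s≤s le) = infer₁ ∧R⁻₁ (contractionʳ q (_ , d , le))
contractionʳ q (_ , ∧R⁻₂ d , s≤s le) = infer₁ ∧R⁻₂ (contractionʳ q (_ , d , le))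
contractionʳ q (_ , ∧La p d , s≤s le) = infer₁ (∧La p) (contractionʳ q (_ , d , le))
contractionʳ q (_ , ∧Lc {A = A} {B = B} p d e , s≤s le) with ∷-↭-∷∷-cases (trans (↭-sym p) q)
... | inj₁ (refl , r) =
  infer₂ (∧Lc ↭-refl)
    (contractionʳ ↭-refl (invertʳ ∧Lc-inversion₁ (++⁺ˡ-∷ [ A ] r) (_ , d , ⊔≤ˡ le)))
    (contractionʳ ↭-refl (invertʳ ∧Lc-inversion₂ (++⁺ˡ-∷ [ B ] r) (_ , e , ⊔≤ʳ le)))
... | inj₂ (_ , r₀ , r) =
  infer₂ (∧Lc (++⁺ˡ-∷ [ _ ] r₀))
    (≤h-exchange ↭-refl (unshift [ A ]) (contractionʳ (++⁺ˡ-∷∷ [ A ] r) (_ , d , ⊔≤ˡ le)))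
    (≤h-exchange ↭-refl (unshift [ B ]) (contractionʳ (++⁺ˡ-∷∷ [ B ] r) (_ , e , ⊔≤ʳ le)))
contractionʳ q (_ , ∨R⁺₁ d , s≤s le) = infer₁ ∨R⁺₁ (contractionʳ q (_ , d , le))
contractionʳ q (_ , ∨R⁺₂ d , s≤s le) = infer₁ ∨R⁺₂ (contractionʳ q (_ , d , le))
contractionʳ q (_ , ∨R⁻ d e , s≤s le) =
  infer₂ ∨R⁻ (contractionʳ q (_ , d , ⊔≤ˡ le)) (contractionʳ q (_ , e , ⊔≤ʳ le))
contractionʳ q (_ , ∨La p d e , s≤s le) =
  infer₂ (∨La p) (contractionʳ q (_ , d , ⊔≤ˡ le)) (contractionʳ q (_ , e , ⊔≤ʳ le))
contractionʳ q (_ , ∨Lc {A = A} {B = B} p d , s≤s le) with ∷-↭-∷∷-cases (trans (↭-sym p) q)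
... | inj₁ (refl , r) =
  infer₁ (∨Lc ↭-refl) (≤h-exchange ↭-refl (swap B A ↭-refl)
    (contractionʳ (trans (swap A B ↭-refl) (prep B (swap A B ↭-refl)))
      (contractionʳ (prep A (swap B A ↭-refl))
        (invertʳ ∨Lc-inversion (++⁺ˡ-∷ (A ∷ B ∷ []) r) (_ , d , le)))))
... | inj₂ (_ , r₀ , r) =
  infer₁ (∨Lc (++⁺ˡ-∷ [ _ ] r₀))
    (≤h-exchange ↭-refl (unshift (A ∷ B ∷ [])) (contractionʳ (++⁺ˡ-∷∷ (A ∷ B ∷ []) r) (_ , d , le)))
contractionʳ q (_ , ⇒R⁺ d , s≤s le) = infer₁ ⇒R⁺ (contractionʳ q (_ , d , le))
contractionʳ q (_ , ⇒R⁻ d e , s≤s le) =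
  infer₂ ⇒R⁻ (contractionʳ q (_ , d , ⊔≤ˡ le)) (contractionʳ q (_ , e , ⊔≤ʳ le))
contractionʳ q (_ , ⇒La p d e , s≤s le) =
  infer₂ (⇒La p) (contractionʳ q (_ , d , ⊔≤ˡ le)) (contractionʳ q (_ , e , ⊔≤ʳ le))
contractionʳ q (_ , ⇒Lc {B = B} p d , s≤s le) with ∷-↭-∷∷-cases (trans (↭-sym p) q)
... | inj₁ (refl , r) =
  infer₁ (⇒Lc ↭-refl)
    (contractionʳ ↭-refl (contractionˡ ↭-refl (invertʳ ⇒Lc-inversion (++⁺ˡ-∷ [ B ] r) (_ , d , le))))
... | inj₂ (_ , r₀ , r) =
  infer₁ (⇒Lc (++⁺ˡ-∷ [ _ ] r₀))
    (≤h-exchange ↭-refl (unshift [ B ]) (contractionʳ (++⁺ˡ-∷∷ [ B ] r) (_ , d , le)))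
contractionʳ q (_ , -<R⁺ d e , s≤s le) =
  infer₂ -<R⁺ (contractionʳ q (_ , d , ⊔≤ˡ le)) (contractionʳ q (_ , e , ⊔≤ʳ le))
contractionʳ q (_ , -<R⁻ {B = B} d , s≤s le) =
  infer₁ -<R⁻ (≤h-exchange ↭-refl (unshift [ B ]) (contractionʳ (++⁺ˡ-∷∷ [ B ] q) (_ , d , le)))
contractionʳ q (_ , -<La {B = B} p d , s≤s le) =
  infer₁ (-<La p) (≤h-exchange ↭-refl (unshift [ B ]) (contractionʳ (++⁺ˡ-∷∷ [ B ] q) (_ , d , le)))
contractionʳ q (_ , -<Lc {A = A} p d e , s≤s le) with ∷-↭-∷∷-cases (trans (↭-sym p) q)
... | inj₁ (refl , r) =
  infer₂ (-<Lc ↭-refl)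
    (contractionʳ q (_ , d , ⊔≤ˡ le))
    (contractionʳ ↭-refl (invertʳ -<Lc-inversion (++⁺ˡ-∷ [ A ] r) (_ , e , ⊔≤ʳ le)))
... | inj₂ (_ , r₀ , r) =
  infer₂ (-<Lc (++⁺ˡ-∷ [ _ ] r₀))
    (contractionʳ q (_ , d , ⊔≤ˡ le))
    (≤h-exchange ↭-refl (unshift [ A ]) (contractionʳ (++⁺ˡ-∷∷ [ A ] r) (_ , e , ⊔≤ʳ le)))

theorem3p3p2 : ∀ (Γ Δ : Ctx) (D C : Fm) (s : Pol) (n : ℕ)
    → ((D ∷ D ∷ Γ) ⨾ Δ ⊢[ s ] C ≤h n → (D ∷ Γ) ⨾ Δ ⊢[ s ] C ≤h n)
    × (Γ ⨾ (D ∷ D ∷ Δ) ⊢[ s ] C ≤h n → Γ ⨾ (D ∷ Δ) ⊢[ s ] C ≤h n)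
theorem3p3p2 Γ Δ D C s n = contractionˡ ↭-refl , contractionʳ ↭-refl
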